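{- Let $p$ be a prime, $n\ge2$, $0<\delta<1$ an integer power of $p$, $t\in\mathbb{N}$ and $Q=p^t$. Let $\xi_i=p^{ -b_i}$ ($0\le i\le n$) with integers $b_i\ge0$, $\sum_{i=0}^nb_i=t(n+1)$ (so $\prod_i\xi_i=Q^{ -(n+1)}$), and $0<\xi_0\le\xi_1\le\dots\le\xi_n=1$. For $0\le i\le n$ let $g_i$ be the integer power of $p$ with $|g_i|_p=\delta/\xi_i$, and let $d=\frac{1}{\delta Q}$. Assume that $\xi_0\le Q^{ -1-v}$ for some $0<v\le1$. Then for every $1\le k\le n$, $$\prod_{i=0}^{k-1}d|g_i|_p\ \ge\ Q^v.$$
   Context: $|\cdot|_p$ is the $p$-adic absolute value.
   Formalization: The parameter v, in the hypothesis $\xi_0\le Q^{ -1-v}$ and in the conclusion, ranges over the rationals with 0 < v ≤ 1. -}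

module Defs where

open import Data.Nat as ℕ using (ℕ; zero; suc)
open import Data.Nat.Divisibility using (_∣?_; divides)
open import Data.Integer as ℤ using (ℤ; +_; -[1+_]; ∣_∣)
open import Data.Rational using (ℚ; 0ℚ; 1ℚ; _*_; _/_; 1/_; ≢-nonZero; ↥_; ↧ₙ_)
open import Data.Rational.Properties using (_≟_)
open import Relation.Nullary using (yes; no)

ℕ→ℚ : ℕ → ℚ
ℕ→ℚ n = (+ n) / 1

_^ℕ_ : ℚ → ℕ → ℚ
x ^ℕ zero  = 1ℚ
x ^ℕ suc n = x * (x ^ℕ n)

-- Total reciprocal (1/0 := 0; only ever used on nonzero arguments).
recip : ℚ → ℚ
recip x with x ≟ 0ℚ
... | yes _  = 0ℚ
... | no x≢0 = (1/ x) {{≢-nonZero x≢0}}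

_÷'_ : ℚ → ℚ → ℚ
x ÷' y = x * recip y

_^ℤ_ : ℚ → ℤ → ℚ
x ^ℤ (+ n)    = x ^ℕ n
x ^ℤ -[1+ n ] = recip (x ^ℕ suc n)

-- p-adic valuation of a natural number m, computed with fuel f
-- (fuel m suffices for p ≥ 2, m ≥ 1).
vpFuel : ℕ → ℕ → ℕ → ℕ
vpFuel p zero    m = 0
vpFuel p (suc f) m with p ∣? m
... | yes (divides q _) = suc (vpFuel p f q)
... | no  _             = 0

vpℕ : ℕ → ℕ → ℕ
vpℕ p m = vpFuel p m m

padicAbs : ℕ → ℚ → ℚ
padicAbs p x with ∣ ↥ x ∣
... | zero  = 0ℚ
... | suc a = ℕ→ℚ p ^ℤ (+ vpℕ p (↧ₙ x) ℤ.- + vpℕ p (suc a))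

sumTo : ℕ → (ℕ → ℕ) → ℕ
sumTo zero    f = 0
sumTo (suc k) f = sumTo k f ℕ.+ f k

prodTo : ℕ → (ℕ → ℚ) → ℚ
prodTo zero    f = 1ℚ
prodTo (suc k) f = prodTo k f * f k

-- Real powers with rational exponent, compared with a positive rational x:
-- for v = r/s (s ≥ 1, lowest terms) and Q > 0, x > 0:
--   Q^v ≤ x  iff  Q^r ≤ x^s.
-- (Used for x > 0 only.)
RatPowLE : ℚ → ℚ → ℚ → Set
RatPowLE Q v x = (Q ^ℤ (↥ v)) Data.Rational.≤ (x ^ℕ (↧ₙ v))
  where import Data.Rational

-- x ≤ Q^v  iff  x^s ≤ Q^r   (for v = r/s, x > 0, Q > 0).
LERatPow : ℚ → ℚ → ℚ → Set
LERatPow x Q v = (x ^ℕ (↧ₙ v)) Data.Rational.≤ (Q ^ℤ (↥ v))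
  where import Data.Rational

{-# OPTIONS --safe #-}
module Submission where

-- Write ξᵢ = p^(-bᵢ), so that b₀ ≥ b₁ ≥ … ≥ bₙ = 0 and b₀ + … + bₙ = t(n+1),
-- and v = r/s.  Since d|gᵢ|_p = p^bᵢ / Q, the product over i < k equals p^(Sₖ - kt)
-- with Sₖ = b₀ + … + b₍ₖ₋₁₎, so the claim is the exponent inequality
-- t(r + ks) ≤ s Sₖ, while the hypothesis on ξ₀ says t(r + s) ≤ s b₀.
-- If bₖ ≥ t, then all bᵢ with i < k are ≥ t, so Sₖ ≥ b₀ + (k-1)t and the hypothesis
-- on ξ₀ gives the claim.  If bₖ ≤ t, then all bᵢ with i ≥ k are ≤ t, and since bₙ = 0
-- this gives t(n+1) ≤ Sₖ + (n-k)t, i.e. Sₖ ≥ (k+1)t ≥ kt + tr/s because r ≤ s.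

open import Defs
open import Data.Nat as ℕ using (ℕ; suc)
open import Data.Nat.Primality using (Prime)
open import Data.Integer as ℤ using (ℤ; +_)
open import Data.Rational as ℚ using (ℚ; 0ℚ; 1ℚ)
open import Data.Product using (∃)
open import Relation.Binary.PropositionalEquality using (_≡_)

module PrefixSums where

  open import Data.Nat
  open import Data.Nat.Properties
  open import Data.List using ([]; _∷_)
  open import Data.Nat.Tactic.RingSolver using (solve)
  open import Data.Sum using (inj₁; inj₂)
  open import Relation.Binary.PropositionalEquality

  sumTo-+ : ∀ m k (f : ℕ → ℕ) → sumTo (m + k) f ≡ sumTo m f + sumTo k (λ i → f (m + i))
  sumTo-+ m zero    f = trans (cong (λ j → sumTo j f) (+-identityʳ m)) (sym (+-identityʳ (sumTo m f)))
  sumTo-+ m (suc k) f rewrite +-suc m k =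
    trans (cong (_+ f (m + k)) (sumTo-+ m k f)) (+-assoc (sumTo m f) _ (f (m + k)))

  sumTo-mono-≤ : ∀ k {f g : ℕ → ℕ} → (∀ i → i < k → f i ≤ g i) → sumTo k f ≤ sumTo k g
  sumTo-mono-≤ zero    f≤g = ≤-refl
  sumTo-mono-≤ (suc k) f≤g =
    +-mono-≤ (sumTo-mono-≤ k (λ i i<k → f≤g i (m<n⇒m<1+n i<k))) (f≤g k ≤-refl)

  sumTo-const : ∀ k c → sumTo k (λ _ → c) ≡ k * c
  sumTo-const zero    c = refl
  sumTo-const (suc k) c = trans (cong (_+ c) (sumTo-const k c)) (+-comm (k * c) c)

  module _ {n : ℕ} (b : ℕ → ℕ) (b-step : ∀ i → i < n → b (suc i) ≤ b i) where

    antitone : ∀ {i j} → i ≤ j → j ≤ n → b j ≤ b i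
    antitone i≤j = antitone′ (≤⇒≤′ i≤j)
      where
      antitone′ : ∀ {i j} → i ≤′ j → j ≤ n → b j ≤ b i
      antitone′ ≤′-refl              _     = ≤-refl
      antitone′ (≤′-step {j} i≤′j) 1+j≤n = ≤-trans (b-step j 1+j≤n) (antitone′ i≤′j (<⇒≤ 1+j≤n))

    prefixSum-≥-large : ∀ {t} j → suc j ≤ n → t ≤ b (suc j) → b 0 + j * t ≤ sumTo (suc j) b
    prefixSum-≥-large {t} j k≤n t≤bₖ = begin
      b 0 + j * t                      ≡⟨ cong (λ x → b 0 + x) (sumTo-const j t) ⟨
      b 0 + sumTo j (λ _ → t)          ≤⟨ +-monoʳ-≤ (b 0) (sumTo-mono-≤ j t≤b) ⟩
      b 0 + sumTo j (λ i → b (suc i))  ≡⟨ sumTo-+ 1 j b ⟨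
      sumTo (suc j) b                  ∎
      where
      open ≤-Reasoning
      t≤b : ∀ i → i < j → t ≤ b (suc i)
      t≤b i i<j = ≤-trans t≤bₖ (antitone (m<n⇒m<1+n i<j) k≤n)

    prefixSum-≥-small : ∀ {t} k → k ≤ n → b k ≤ t → sumTo (suc n) b ≡ t * suc n → b n ≡ 0 →
                        t * suc k ≤ sumTo k b
    prefixSum-≥-small {t} k k≤n bₖ≤t Σb bn≡0 = +-cancelʳ-≤ (m * t) _ _ (begin
      t * suc k + m * t                     ≡⟨ cong (λ x → t * suc k + x) (*-comm m t) ⟩
      t * suc k + t * m                     ≡⟨ *-distribˡ-+ t (suc k) m ⟨
      t * suc (k + m)                       ≡⟨ cong (λ j → t * suc j) k+m≡n ⟩
      t * suc n                             ≡⟨ Σb ⟨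
      sumTo n b + b n                       ≡⟨ cong (λ x → sumTo n b + x) bn≡0 ⟩
      sumTo n b + 0                         ≡⟨ +-identityʳ (sumTo n b) ⟩
      sumTo n b                             ≡⟨ cong (λ j → sumTo j b) k+m≡n ⟨
      sumTo (k + m) b                       ≡⟨ sumTo-+ k m b ⟩
      sumTo k b + sumTo m (λ i → b (k + i)) ≤⟨ +-monoʳ-≤ (sumTo k b) (sumTo-mono-≤ m b≤t) ⟩
      sumTo k b + sumTo m (λ _ → t)         ≡⟨ cong (λ x → sumTo k b + x) (sumTo-const m t) ⟩
      sumTo k b + m * t                     ∎)
      where
      open ≤-Reasoning
      m = n ∸ k
      k+m≡n : k + m ≡ n
      k+m≡n = m+[n∸m]≡n k≤n
      b≤t : ∀ i → i < m → b (k + i) ≤ t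
      b≤t i i<m = ≤-trans (antitone (m≤m+n k i) k+i≤n) bₖ≤t
        where
        k+i≤n : k + i ≤ n
        k+i≤n = subst (k + i ≤_) k+m≡n (+-monoʳ-≤ k (<⇒≤ i<m))

    prefixSum-exponentBound : ∀ t {r s} → sumTo (suc n) b ≡ t * suc n → b n ≡ 0 →
                              t * (r + s) ≤ b 0 * s → r ≤ s →
                              ∀ k → 1 ≤ k → k ≤ n → t * (r + k * s) ≤ sumTo k b * s
    prefixSum-exponentBound t {r} {s} Σb bn≡0 t[r+s]≤b₀s r≤s (suc j) _ k≤n
      with ≤-total t (b (suc j))
    ... | inj₁ t≤bₖ = begin
      t * (r + suc j * s)     ≡⟨ solve (t ∷ r ∷ s ∷ j ∷ []) ⟩
      t * (r + s) + j * t * s ≤⟨ +-monoˡ-≤ (j * t * s) t[r+s]≤b₀s ⟩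
      b 0 * s + j * t * s     ≡⟨ *-distribʳ-+ s (b 0) (j * t) ⟨
      (b 0 + j * t) * s       ≤⟨ *-monoˡ-≤ s (prefixSum-≥-large j k≤n t≤bₖ) ⟩
      sumTo (suc j) b * s     ∎
      where open ≤-Reasoning
    ... | inj₂ bₖ≤t = begin
      t * (r + suc j * s)     ≤⟨ *-monoʳ-≤ t (+-monoˡ-≤ (suc j * s) r≤s) ⟩
      t * (s + suc j * s)     ≡⟨ solve (t ∷ s ∷ j ∷ []) ⟩
      t * suc (suc j) * s     ≤⟨ *-monoˡ-≤ s (prefixSum-≥-small (suc j) k≤n bₖ≤t Σb bn≡0) ⟩
      sumTo (suc j) b * s     ∎
      where open ≤-Reasoning

open PrefixSums using (prefixSum-exponentBound)

open import Algebra.Bundles using (CommutativeMonoid; CommutativeRing)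
open import Data.Empty using (⊥-elim)
open import Data.Integer using (-[1+_]; 1ℤ)
import Data.Integer.Properties as ℤP
open import Data.Integer.Tactic.RingSolver using (solve-∀)
open import Data.Nat using (zero)
open import Data.Nat.Coprimality using (Coprime; coprime-+; 1-coprimeTo)
import Data.Nat.Coprimality as Coprimality
open import Data.Nat.Primality using (prime⇒nonTrivial)
import Data.Nat.Properties as ℕP
open import Data.Rational using (_*_; _≤_; _<_; 1/_; mkℚ; toℚᵘ)
import Data.Rational.Properties as ℚP
import Data.Rational.Unnormalised as ℚᵘ
import Data.Rational.Unnormalised.Properties as ℚᵘP
open import Function using (_∘_)
open import Relation.Binary.PropositionalEquality
  using (_≢_; refl; sym; trans; cong; cong₂; subst; subst₂; ≢-sym; module ≡-Reasoning)
open import Relation.Nullary using (yes; no)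
open import Algebra.Properties.CommutativeSemiring.Exp
  (CommutativeRing.commutativeSemiring ℚP.+-*-commutativeRing)
  using (_^_; ^-homo-*; ^-assocʳ; ^-distrib-*)
open import Algebra.Properties.CommutativeSemigroup
  (CommutativeMonoid.commutativeSemigroup ℚP.*-1-commutativeMonoid)
  using (interchange; xy∙z≈x∙zy)

pos⇒≢0 : ∀ {x} → 0ℚ < x → x ≢ 0ℚ
pos⇒≢0 0<x = ≢-sym (ℚP.<⇒≢ 0<x)

*-pos : ∀ {x y} → 0ℚ < x → 0ℚ < y → 0ℚ < x * y
*-pos {x} {y} 0<x 0<y = ℚP.positive⁻¹ _ {{ℚP.pos*pos⇒pos x {{ℚ.positive 0<x}} y {{ℚ.positive 0<y}}}}

1<⇒0< : ∀ {x} → 1ℚ < x → 0ℚ < x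
1<⇒0< = ℚP.<-trans (ℚP.positive⁻¹ 1ℚ)

recip≡1/ : ∀ {x} (x≢0 : x ≢ 0ℚ) → recip x ≡ (1/ x) {{ℚ.≢-nonZero x≢0}}
recip≡1/ {x} x≢0 with x ℚP.≟ 0ℚ
... | yes x≡0 = ⊥-elim (x≢0 x≡0)
... | no  _   = refl

recip-inverseˡ : ∀ {x} → x ≢ 0ℚ → recip x * x ≡ 1ℚ
recip-inverseˡ {x} x≢0 rewrite recip≡1/ x≢0 = ℚP.*-inverseˡ x {{ℚ.≢-nonZero x≢0}}

recip-inverseʳ : ∀ {x} → x ≢ 0ℚ → x * recip x ≡ 1ℚ
recip-inverseʳ {x} x≢0 = trans (ℚP.*-comm x (recip x)) (recip-inverseˡ x≢0)

recip-cancelˡ : ∀ {x} → x ≢ 0ℚ → ∀ y → recip x * (x * y) ≡ y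
recip-cancelˡ {x} x≢0 y = begin
  recip x * (x * y)  ≡⟨ ℚP.*-assoc (recip x) x y ⟨
  (recip x * x) * y  ≡⟨ cong (_* y) (recip-inverseˡ x≢0) ⟩
  1ℚ * y             ≡⟨ ℚP.*-identityˡ y ⟩
  y                  ∎
  where open ≡-Reasoning

recip-unique : ∀ {x y} → x ≢ 0ℚ → y * x ≡ 1ℚ → y ≡ recip x
recip-unique {x} {y} x≢0 yx≡1 = begin
  y                  ≡⟨ ℚP.*-identityʳ y ⟨
  y * 1ℚ             ≡⟨ cong (y *_) (recip-inverseʳ x≢0) ⟨
  y * (x * recip x)  ≡⟨ ℚP.*-assoc y x (recip x) ⟨
  (y * x) * recip x  ≡⟨ cong (_* recip x) yx≡1 ⟩
  1ℚ * recip x       ≡⟨ ℚP.*-identityˡ (recip x) ⟩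
  recip x            ∎
  where open ≡-Reasoning

recip-≢0 : ∀ {x} → x ≢ 0ℚ → recip x ≢ 0ℚ
recip-≢0 {x} x≢0 recip[x]≡0 = ℚP.1≢0 (begin
  1ℚ           ≡⟨ recip-inverseˡ x≢0 ⟨
  recip x * x  ≡⟨ cong (_* x) recip[x]≡0 ⟩
  0ℚ * x       ≡⟨ ℚP.*-zeroˡ x ⟩
  0ℚ           ∎)
  where open ≡-Reasoning

recip-involutive : ∀ {x} → x ≢ 0ℚ → recip (recip x) ≡ x
recip-involutive x≢0 = sym (recip-unique (recip-≢0 x≢0) (recip-inverseʳ x≢0))

recip-antitone : ∀ {x y} → 0ℚ < x → 0ℚ < y → recip x ≤ recip y → y ≤ x
recip-antitone {x} {y} 0<x 0<y recip[x]≤recip[y] = begin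
  y                  ≡⟨ recip-cancelˡ (pos⇒≢0 0<x) y ⟨
  recip x * (x * y)  ≤⟨ ℚP.*-monoʳ-≤-nonNeg (x * y) {{0≤xy}} recip[x]≤recip[y] ⟩
  recip y * (x * y)  ≡⟨ cong (recip y *_) (ℚP.*-comm x y) ⟩
  recip y * (y * x)  ≡⟨ recip-cancelˡ (pos⇒≢0 0<y) x ⟩
  x                  ∎
  where
  open ℚP.≤-Reasoning
  0≤xy : ℚ.NonNegative (x * y)
  0≤xy = ℚ.nonNegative (ℚP.<⇒≤ (*-pos 0<x 0<y))

^ℕ≡^ : ∀ x n → x ^ℕ n ≡ x ^ n
^ℕ≡^ x zero    = refl
^ℕ≡^ x (suc n) = cong (x *_) (^ℕ≡^ x n)

^ℕ-homo-* : ∀ x m n → x ^ℕ (m ℕ.+ n) ≡ x ^ℕ m * x ^ℕ n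
^ℕ-homo-* x m n rewrite ^ℕ≡^ x (m ℕ.+ n) | ^ℕ≡^ x m | ^ℕ≡^ x n = ^-homo-* x m n

^ℕ-assocʳ : ∀ x m n → (x ^ℕ m) ^ℕ n ≡ x ^ℕ (m ℕ.* n)
^ℕ-assocʳ x m n rewrite ^ℕ≡^ (x ^ℕ m) n | ^ℕ≡^ x m | ^ℕ≡^ x (m ℕ.* n) = ^-assocʳ x m n

^ℕ-distrib-* : ∀ x y n → (x * y) ^ℕ n ≡ x ^ℕ n * y ^ℕ n
^ℕ-distrib-* x y n rewrite ^ℕ≡^ (x * y) n | ^ℕ≡^ x n | ^ℕ≡^ y n = ^-distrib-* x y n

1^ℕ : ∀ n → 1ℚ ^ℕ n ≡ 1ℚ
1^ℕ zero    = refl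
1^ℕ (suc n) = trans (ℚP.*-identityˡ (1ℚ ^ℕ n)) (1^ℕ n)

^ℕ-pos : ∀ {x} → 0ℚ < x → ∀ n → 0ℚ < x ^ℕ n
^ℕ-pos 0<x zero    = ℚP.positive⁻¹ 1ℚ
^ℕ-pos 0<x (suc n) = *-pos 0<x (^ℕ-pos 0<x n)

recip-^ℕ : ∀ {x} → 0ℚ < x → ∀ n → recip x ^ℕ n ≡ recip (x ^ℕ n)
recip-^ℕ {x} 0<x n = recip-unique (pos⇒≢0 (^ℕ-pos 0<x n)) (begin
  recip x ^ℕ n * x ^ℕ n  ≡⟨ ^ℕ-distrib-* (recip x) x n ⟨
  (recip x * x) ^ℕ n     ≡⟨ cong (_^ℕ n) (recip-inverseˡ (pos⇒≢0 0<x)) ⟩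
  1ℚ ^ℕ n                ≡⟨ 1^ℕ n ⟩
  1ℚ                     ∎)
  where open ≡-Reasoning

^ℤ-neg : ∀ x n → x ^ℤ (ℤ.- (+ n)) ≡ recip (x ^ℕ n)
^ℤ-neg x zero    = refl
^ℤ-neg x (suc n) = refl

prodTo-cong : ∀ k {f g : ℕ → ℚ} → (∀ i → i ℕ.< k → f i ≡ g i) → prodTo k f ≡ prodTo k g
prodTo-cong zero    f≡g = refl
prodTo-cong (suc k) f≡g =
  cong₂ _*_ (prodTo-cong k (λ i i<k → f≡g i (ℕP.m<n⇒m<1+n i<k))) (f≡g k ℕP.≤-refl)

prodTo-*-^ℕ : ∀ k f c → prodTo k f * c ^ℕ k ≡ prodTo k (λ i → f i * c)
prodTo-*-^ℕ zero    f c = ℚP.*-identityˡ 1ℚ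
prodTo-*-^ℕ (suc k) f c = begin
  (prodTo k f * f k) * (c * c ^ℕ k)  ≡⟨ cong ((prodTo k f * f k) *_) (ℚP.*-comm c (c ^ℕ k)) ⟩
  (prodTo k f * f k) * (c ^ℕ k * c)  ≡⟨ interchange (prodTo k f) (f k) (c ^ℕ k) c ⟩
  (prodTo k f * c ^ℕ k) * (f k * c)  ≡⟨ cong (_* (f k * c)) (prodTo-*-^ℕ k f c) ⟩
  prodTo k (λ i → f i * c) * (f k * c) ∎
  where open ≡-Reasoning

prodTo-^ℕ : ∀ x k f → prodTo k (λ i → x ^ℕ f i) ≡ x ^ℕ sumTo k f
prodTo-^ℕ x zero    f = refl
prodTo-^ℕ x (suc k) f = trans (cong (_* x ^ℕ f k) (prodTo-^ℕ x k f)) (sym (^ℕ-homo-* x (sumTo k f) (f k)))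

1<ℕ→ℚ : ∀ {m} → 1 ℕ.< m → 1ℚ < ℕ→ℚ m
1<ℕ→ℚ {m} 1<m = subst (1ℚ <_) (sym (ℚP.↥p/↧p≡p (mkℚ (+ m) 0 (Coprimality.sym (1-coprimeTo m)))))
  (ℚ.*<* (subst (+ 1 ℤ.<_) (sym (ℤP.*-identityʳ (+ m))) (ℤ.+<+ 1<m)))

-- LERatPow reads off the numerator and denominator of the normalised exponent -1 - v.
-1-[r/s]≡ : ∀ r d .(c : Coprime r (suc d)) →
            ℚ.- 1ℚ ℚ.- mkℚ (+ r) d c ≡ mkℚ -[1+ d ℕ.+ r ] d (coprime-+ c)
-1-[r/s]≡ r d c = ℚP.toℚᵘ-injective (begin
  toℚᵘ (ℚ.- 1ℚ ℚ.- v)                       ≈⟨ ℚP.toℚᵘ-homo-+ (ℚ.- 1ℚ) (ℚ.- v) ⟩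
  toℚᵘ (ℚ.- 1ℚ) ℚᵘ.+ toℚᵘ (ℚ.- v)           ≈⟨ ℚᵘP.+-congʳ (toℚᵘ (ℚ.- 1ℚ)) (ℚP.toℚᵘ-homo‿- v) ⟩
  toℚᵘ (ℚ.- 1ℚ) ℚᵘ.+ ℚᵘ.- toℚᵘ v            ≈⟨ ℚᵘ.*≡* cross-multiplied ⟩
  toℚᵘ (mkℚ -[1+ d ℕ.+ r ] d (coprime-+ c))  ∎)
  where
  open ℚᵘP.≃-Reasoning
  v = mkℚ (+ r) d c
  cross-multiplied : (-[1+ 0 ] ℤ.* + suc d ℤ.+ ℤ.- (+ r) ℤ.* + 1) ℤ.* + suc d
                     ≡ -[1+ d ℕ.+ r ] ℤ.* + (1 ℕ.* suc d)
  cross-multiplied = trans (identity (+ suc d) (+ r))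
                           (cong (λ m → -[1+ d ℕ.+ r ] ℤ.* + m) (sym (ℕP.*-identityˡ (suc d))))
    where
    identity : ∀ s r → (ℤ.- 1ℤ ℤ.* s ℤ.+ ℤ.- r ℤ.* 1ℤ) ℤ.* s ≡ ℤ.- (s ℤ.+ r) ℤ.* s
    identity = solve-∀

[r/s]≤1⇒r≤s : ∀ {r d} .{c : Coprime r (suc d)} → mkℚ (+ r) d c ≤ 1ℚ → r ℕ.≤ suc d
[r/s]≤1⇒r≤s {r} {d} v≤1 = ℤP.drop‿+≤+
  (subst₂ ℤ._≤_ (ℤP.*-identityʳ (+ r)) (ℤP.*-identityˡ (+ suc d)) (ℚP.drop-*≤* v≤1))

module _ {P : ℚ} (1<P : 1ℚ < P) where

  private
    0<P : 0ℚ < P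
    0<P = 1<⇒0< 1<P

  ^ℕ-<-suc : ∀ n → P ^ℕ n < P ^ℕ suc n
  ^ℕ-<-suc n = subst (_< P ^ℕ suc n) (ℚP.*-identityˡ (P ^ℕ n))
                 (ℚP.*-monoˡ-<-pos (P ^ℕ n) {{ℚ.positive (^ℕ-pos 0<P n)}} 1<P)

  ^ℕ-mono-≤ : ∀ {m n} → m ℕ.≤ n → P ^ℕ m ≤ P ^ℕ n
  ^ℕ-mono-≤ m≤n = mono′ (ℕP.≤⇒≤′ m≤n)
    where
    mono′ : ∀ {m n} → m ℕ.≤′ n → P ^ℕ m ≤ P ^ℕ n
    mono′ ℕ.≤′-refl            = ℚP.≤-refl
    mono′ (ℕ.≤′-step {n} m≤′n) = ℚP.≤-trans (mono′ m≤′n) (ℚP.<⇒≤ (^ℕ-<-suc n))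

  ^ℕ-mono-< : ∀ {m n} → m ℕ.< n → P ^ℕ m < P ^ℕ n
  ^ℕ-mono-< {m} m<n = ℚP.<-≤-trans (^ℕ-<-suc m) (^ℕ-mono-≤ m<n)

  ^ℕ-cancel-≤ : ∀ {m n} → P ^ℕ m ≤ P ^ℕ n → m ℕ.≤ n
  ^ℕ-cancel-≤ {m} {n} Pᵐ≤Pⁿ with m ℕP.≤? n
  ... | yes m≤n = m≤n
  ... | no  m≰n = ⊥-elim (ℚP.<-irrefl refl (ℚP.<-≤-trans (^ℕ-mono-< (ℕP.≰⇒> m≰n)) Pᵐ≤Pⁿ))

  ^ℤ-neg-cancel-≤ : ∀ {m n} → P ^ℤ (ℤ.- (+ m)) ≤ P ^ℤ (ℤ.- (+ n)) → n ℕ.≤ m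
  ^ℤ-neg-cancel-≤ {m} {n} P⁻ᵐ≤P⁻ⁿ = ^ℕ-cancel-≤ (recip-antitone (^ℕ-pos 0<P m) (^ℕ-pos 0<P n)
    (subst₂ _≤_ (^ℤ-neg P m) (^ℤ-neg P n) P⁻ᵐ≤P⁻ⁿ))

  ^ℤ-neg≡1⇒≡0 : ∀ {m} → P ^ℤ (ℤ.- (+ m)) ≡ 1ℚ → m ≡ 0
  ^ℤ-neg≡1⇒≡0 {m} P⁻ᵐ≡1 = ℕP.n≤0⇒n≡0 (^ℕ-cancel-≤ (ℚP.≤-reflexive (begin
    P ^ℕ m                  ≡⟨ recip-involutive (pos⇒≢0 (^ℕ-pos 0<P m)) ⟨
    recip (recip (P ^ℕ m))  ≡⟨ cong recip (trans (sym (^ℤ-neg P m)) P⁻ᵐ≡1) ⟩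
    recip 1ℚ                ∎)))
    where open ≡-Reasoning

  LERatPow-exponent : ∀ b₀ t {r d} .{c : Coprime r (suc d)} →
    LERatPow (P ^ℤ (ℤ.- (+ b₀))) (P ^ℕ t) (ℚ.- 1ℚ ℚ.- mkℚ (+ r) d c) →
    t ℕ.* (r ℕ.+ suc d) ℕ.≤ b₀ ℕ.* suc d
  LERatPow-exponent b₀ t {r} {d} {c} ξ₀≤ = subst (λ e → t ℕ.* e ℕ.≤ b₀ ℕ.* s) (ℕP.+-comm s r)
    (^ℕ-cancel-≤ (recip-antitone (^ℕ-pos 0<P (b₀ ℕ.* s)) (^ℕ-pos 0<P (t ℕ.* (s ℕ.+ r))) (begin
      recip (P ^ℕ (b₀ ℕ.* s))       ≡⟨ cong recip (^ℕ-assocʳ P b₀ s) ⟨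
      recip ((P ^ℕ b₀) ^ℕ s)        ≡⟨ recip-^ℕ (^ℕ-pos 0<P b₀) s ⟨
      recip (P ^ℕ b₀) ^ℕ s          ≡⟨ cong (_^ℕ s) (^ℤ-neg P b₀) ⟨
      (P ^ℤ (ℤ.- (+ b₀))) ^ℕ s      ≤⟨ subst (LERatPow (P ^ℤ (ℤ.- (+ b₀))) (P ^ℕ t)) (-1-[r/s]≡ r d c) ξ₀≤ ⟩
      recip ((P ^ℕ t) ^ℕ (s ℕ.+ r)) ≡⟨ cong recip (^ℕ-assocʳ P t (s ℕ.+ r)) ⟩
      recip (P ^ℕ (t ℕ.* (s ℕ.+ r))) ∎)))
    where
    open ℚP.≤-Reasoning
    s = suc d

  exponentBound⇒Qʳ≤Xˢ : ∀ t k S r s X → X * (P ^ℕ t) ^ℕ k ≡ P ^ℕ S →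
                        t ℕ.* (r ℕ.+ k ℕ.* s) ℕ.≤ S ℕ.* s → (P ^ℕ t) ^ℕ r ≤ X ^ℕ s
  exponentBound⇒Qʳ≤Xˢ t k S r s X XQᵏ≡Pˢ exponent≤ =
    ℚP.*-cancelʳ-≤-pos (Qᵏ ^ℕ s) {{ℚ.positive (^ℕ-pos (^ℕ-pos (^ℕ-pos 0<P t) k) s)}} (begin
      Q ^ℕ r * Qᵏ ^ℕ s          ≡⟨ cong (Q ^ℕ r *_) (^ℕ-assocʳ Q k s) ⟩
      Q ^ℕ r * Q ^ℕ (k ℕ.* s)   ≡⟨ ^ℕ-homo-* Q r (k ℕ.* s) ⟨
      Q ^ℕ (r ℕ.+ k ℕ.* s)      ≡⟨ ^ℕ-assocʳ P t (r ℕ.+ k ℕ.* s) ⟩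
      P ^ℕ (t ℕ.* (r ℕ.+ k ℕ.* s)) ≤⟨ ^ℕ-mono-≤ exponent≤ ⟩
      P ^ℕ (S ℕ.* s)            ≡⟨ ^ℕ-assocʳ P S s ⟨
      (P ^ℕ S) ^ℕ s             ≡⟨ cong (_^ℕ s) XQᵏ≡Pˢ ⟨
      (X * Qᵏ) ^ℕ s             ≡⟨ ^ℕ-distrib-* X Qᵏ s ⟩
      X ^ℕ s * Qᵏ ^ℕ s          ∎)
    where
    open ℚP.≤-Reasoning
    Q = P ^ℕ t
    Qᵏ = Q ^ℕ k

  ∏d|g|*Qᵏ≡P^Σb : ∀ {δ Q} (G : ℕ → ℚ) (b : ℕ → ℕ) k → 0ℚ < δ → 0ℚ < Q →
                  (∀ i → i ℕ.< k → G i ≡ δ ÷' (P ^ℤ (ℤ.- (+ b i)))) →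
                  prodTo k (λ i → recip (δ * Q) * G i) * Q ^ℕ k ≡ P ^ℕ sumTo k b
  ∏d|g|*Qᵏ≡P^Σb {δ} {Q} G b k 0<δ 0<Q G≡δ÷ξ = begin
    prodTo k d|g| * Q ^ℕ k        ≡⟨ prodTo-*-^ℕ k d|g| Q ⟩
    prodTo k (λ i → d|g| i * Q)   ≡⟨ prodTo-cong k d|g|*Q≡ ⟩
    prodTo k (λ i → P ^ℕ b i)     ≡⟨ prodTo-^ℕ P k b ⟩
    P ^ℕ sumTo k b                ∎
    where
    open ≡-Reasoning
    d|g| : ℕ → ℚ
    d|g| i = recip (δ * Q) * G i
    d|g|*Q≡ : ∀ i → i ℕ.< k → d|g| i * Q ≡ P ^ℕ b i
    d|g|*Q≡ i i<k = begin
      recip (δ * Q) * G i * Q         ≡⟨ cong (λ z → recip (δ * Q) * z * Q) G≡δPᵇ ⟩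
      recip (δ * Q) * (δ * Pᵇ) * Q    ≡⟨ ℚP.*-assoc (recip (δ * Q)) (δ * Pᵇ) Q ⟩
      recip (δ * Q) * (δ * Pᵇ * Q)    ≡⟨ cong (recip (δ * Q) *_) (xy∙z≈x∙zy δ Pᵇ Q) ⟩
      recip (δ * Q) * (δ * (Q * Pᵇ))  ≡⟨ cong (recip (δ * Q) *_) (ℚP.*-assoc δ Q Pᵇ) ⟨
      recip (δ * Q) * (δ * Q * Pᵇ)    ≡⟨ recip-cancelˡ (pos⇒≢0 (*-pos 0<δ 0<Q)) Pᵇ ⟩
      Pᵇ                              ∎
      where
      Pᵇ = P ^ℕ b i
      G≡δPᵇ : G i ≡ δ * Pᵇ
      G≡δPᵇ = begin
        G i                             ≡⟨ G≡δ÷ξ i i<k ⟩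
        δ * recip (P ^ℤ (ℤ.- (+ b i)))  ≡⟨ cong (λ z → δ * recip z) (^ℤ-neg P (b i)) ⟩
        δ * recip (recip Pᵇ)            ≡⟨ cong (δ *_) (recip-involutive (pos⇒≢0 (^ℕ-pos 0<P (b i)))) ⟩
        δ * Pᵇ                          ∎

corollary5p6 : (p : ℕ) → Prime p →
    (n : ℕ) → 2 ℕ.≤ n →
    (δ : ℚ) → ∃ (λ (e : ℤ) → δ ≡ ℕ→ℚ p ^ℤ e) → 0ℚ ℚ.< δ → δ ℚ.< 1ℚ →
    (t : ℕ) →
    (b : ℕ → ℕ) →
    sumTo (suc n) b ≡ t ℕ.* suc n →
    (∀ i → i ℕ.< n → ℕ→ℚ p ^ℤ (ℤ.- (+ b i)) ℚ.≤ ℕ→ℚ p ^ℤ (ℤ.- (+ b (suc i)))) →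
    ℕ→ℚ p ^ℤ (ℤ.- (+ b n)) ≡ 1ℚ →
    (g : ℕ → ℚ) →
    (∀ i → i ℕ.≤ n → ∃ (λ (m : ℤ) → g i ≡ ℕ→ℚ p ^ℤ m)) →
    (∀ i → i ℕ.≤ n → padicAbs p (g i) ≡ δ ÷' (ℕ→ℚ p ^ℤ (ℤ.- (+ b i)))) →
    (v : ℚ) → 0ℚ ℚ.< v → v ℚ.≤ 1ℚ →
    LERatPow (ℕ→ℚ p ^ℤ (ℤ.- (+ b 0))) (ℕ→ℚ p ^ℕ t) (ℚ.- 1ℚ ℚ.- v) →
    (k : ℕ) → 1 ℕ.≤ k → k ℕ.≤ n →
    RatPowLE (ℕ→ℚ p ^ℕ t) v
      (prodTo k (λ i → recip (δ ℚ.* (ℕ→ℚ p ^ℕ t)) ℚ.* padicAbs p (g i)))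
corollary5p6 _ _ _ _ _ _ _ _ _ _ _ _ _ _ _ _ (mkℚ -[1+ _ ] _ _) 0<v _ _ _ _ _
  with () ← ℚP.drop-*<* 0<v
corollary5p6 p p-prime n _ δ _ 0<δ _ t b Σb≡ ξ-mono ξₙ≡1 g _ |g|≡ (mkℚ (+ r) d c) _ v≤1 ξ₀≤ k 1≤k k≤n =
  exponentBound⇒Qʳ≤Xˢ 1<P t k (sumTo k b) r s (prodTo k d|g|) ∏d|g|*Qᵏ≡Pˢ exponent≤
  where
  P = ℕ→ℚ p
  s = suc d
  1<P : 1ℚ < P
  1<P = 1<ℕ→ℚ (ℕ.nonTrivial⇒n>1 p {{prime⇒nonTrivial p-prime}})
  d|g| : ℕ → ℚ
  d|g| i = recip (δ * P ^ℕ t) * padicAbs p (g i)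
  ∏d|g|*Qᵏ≡Pˢ : prodTo k d|g| * (P ^ℕ t) ^ℕ k ≡ P ^ℕ sumTo k b
  ∏d|g|*Qᵏ≡Pˢ = ∏d|g|*Qᵏ≡P^Σb 1<P (padicAbs p ∘ g) b k 0<δ (^ℕ-pos (1<⇒0< 1<P) t)
                  (λ i i<k → |g|≡ i (ℕP.<⇒≤ (ℕP.<-≤-trans i<k k≤n)))
  ξ₀-exponent : t ℕ.* (r ℕ.+ s) ℕ.≤ b 0 ℕ.* s
  ξ₀-exponent = LERatPow-exponent 1<P (b 0) t ξ₀≤
  exponent≤ : t ℕ.* (r ℕ.+ k ℕ.* s) ℕ.≤ sumTo k b ℕ.* s
  exponent≤ = prefixSum-exponentBound b (λ i i<n → ^ℤ-neg-cancel-≤ 1<P (ξ-mono i i<n)) t Σb≡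
                (^ℤ-neg≡1⇒≡0 1<P ξₙ≡1) ξ₀-exponent ([r/s]≤1⇒r≤s v≤1) k 1≤k k≤n
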